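{- Let $\mathbb{B}$ be a complete Boolean algebra, $\mathcal{A}_{\mathbb{B}}$ the associated realizability algebra with names $\mathbf{N}^{\mathcal{A}}$, and $\mathbf{V}^{\mathbb{B}}$ the Boolean-valued model. For every formula $\varphi(x_0,\dots,x_n)$ of the language $\{\in,\simeq\}$, every $t\in\Lambda$ and all $a_0,\dots,a_n\in\mathbf{N}^{\mathcal{A}}$: $t\Vdash\varphi(a_0,\dots,a_n)$ if and only if $\tau(t)\le[\![\varphi(\tau(a_0),\dots,\tau(a_n))]\!]$.
   Context: Krivine realizability basics: possibly open $\lambda_c$-terms are built from variables, application $ts$, abstraction $\lambda u.t$, $\mathsf{cc}$, and continuation constants $\mathsf{k}_\pi$ ($\pi\in\Pi$); $\Lambda$ is the set of closed terms, stacks $\Pi$ are built from stack bottoms and $t\cdot\pi$. Names: $\mathbf{N}^{\mathcal{A}}_\alpha=\bigcup_{\beta<\alpha}\mathcal{P}(\mathbf{N}^{\mathcal{A}}_\beta\times\Pi)$, $\mathbf{N}^{\mathcal{A}}=\bigcup_\alpha\mathbf{N}^{\mathcal{A}}_\alpha$. Falsity values: $\|\top\|=\emptyset$, $\|\perp\|=\Pi$, $\|a\notin b\|=\{t\cdot t'\cdot\pi:\exists c((c,\pi)\in b,t\Vdash a\subseteq c,t'\Vdash c\subseteq a)\}$, $\|a\subseteq b\|=\{t\cdot\pi:\exists c((c,\pi)\in a,t\Vdash c\notin b)\}$, $\|\varphi\to\psi\|=\{t\cdot\pi:t\Vdash\varphi,\pi\in\|\psi\|\}$, $\|\forall x\varphi\|=\bigcup_{a\in\mathbf{N}^{\mathcal{A}}}\|\varphi(a)\|$;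 $t\Vdash\varphi$ iff $t\star\pi\in\perp\!\!\!\perp$ for all $\pi\in\|\varphi\|$. In the realizability structure, formulas of $\{\in,\simeq\}$ are read via: $a\in b:=a\notin b\to\perp$, $a\simeq b:=((a\subseteq b)\to((b\subseteq a)\to\perp))\to\perp$, other connectives as the usual classical abbreviations in $\to,\perp,\forall$. In $\mathbf{V}^{\mathbb{B}}$ (the standard Boolean-valued universe with truth values $[\![\cdot]\!]$) $\in$ and $\simeq$ are interpreted as $\in$ and $=$. The algebra $\mathcal{A}_{\mathbb{B}}$: no special instructions; stack bottoms $\omega_p$ for $p\in\mathbb{B}$. Define $\tau$: $\tau(\omega_p)=p$; $\tau(x)=\tau(\mathsf{cc})=\mathbb{1}$ for variables $x$; $\tau(t\cdot\pi)=\tau(t)\wedge\tau(\pi)$; $\tau(ts)=\tau(t)\wedge\tau(s)$; $\tau(\lambda u.t)=\tau(t)$; $\tau(\mathsf{k}_\pi)=\tau(\pi)$; $\tau(t\star\pi)=\tau(t)\wedge\tau(\pi)$. Preorder: $t\star\pi\succ s\star\sigma$ iff $\tau(t\star\pi)\le\tau(s\star\sigma)$; pole $\perp\!\!\!\perp=\{t\star\pi:\tau(t\star\pi)=\mathbb{0}\}$. For names, recursively, $\tau(a)$ is the function with domain $\{\tau(x):x\in\mathrm{dom}(a)\}$ given by $\tau(a)(\tau(x))=\bigvee\{\tau(\pi):(x,\pi)\in a\}$, where $\mathrm{dom}(a)=\{x:\exists\pi(x,\pi)\in a\}$. -}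

module Defs where

open import Level using (Level; Lift; lift; 0ℓ) renaming (suc to lsuc)
open import Data.Nat using (ℕ; zero; suc)
open import Data.Fin using (Fin)
open import Data.Product using (Σ; _×_; _,_)
open import Data.Unit using (⊤; tt)
open import Data.Empty using (⊥)
open import Data.Vec.Functional using (Vector; _∷_)
open import Relation.Binary.PropositionalEquality using (_≡_)
open import Algebra.Lattice.Bundles using (BooleanAlgebra)

-- Complete Boolean algebras
-- Carrier in Set; meets and joins exist for all families indexed by a
-- type in Set₁ (enough to index by names / by elements of V^B).

record CompleteBooleanAlgebra : Set₂ where
  field
    boolAlg : BooleanAlgebra 0ℓ 0ℓ
  open BooleanAlgebra boolAlg public

  _≤_ : Carrier → Carrier → Set
  x ≤ y = (x ∧ y) ≈ x

  field
    ⋁ : {I : Set₁} → (I → Carrier) → Carrier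
    ⋀ : {I : Set₁} → (I → Carrier) → Carrier
    ⋁-upper : {I : Set₁} (f : I → Carrier) (i : I) → f i ≤ ⋁ f
    ⋁-least : {I : Set₁} (f : I → Carrier) (z : Carrier) →
              ((i : I) → f i ≤ z) → ⋁ f ≤ z
    ⋀-lower : {I : Set₁} (f : I → Carrier) (i : I) → ⋀ f ≤ f i
    ⋀-greatest : {I : Set₁} (f : I → Carrier) (z : Carrier) →
                 ((i : I) → z ≤ f i) → z ≤ ⋀ f

  ⋁₀ : {I : Set} → (I → Carrier) → Carrier
  ⋁₀ {I} f = ⋁ {Lift (lsuc 0ℓ) I} (λ { (lift i) → f i })

  ⋀₀ : {I : Set} → (I → Carrier) → Carrier
  ⋀₀ {I} f = ⋀ {Lift (lsuc 0ℓ) I} (λ { (lift i) → f i })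

  _⇨_ : Carrier → Carrier → Carrier
  x ⇨ y = (¬ x) ∨ y

-- First-order formulas of the language {∈, ≃} with free variables in
-- Fin n; the remaining connectives are the classical abbreviations in
-- →, ⊥, ∀ (as in the paper), so these are the primitive constructors.

data Formula (n : ℕ) : Set where
  _∈'_ : Fin n → Fin n → Formula n
  _≃'_ : Fin n → Fin n → Formula n
  ⊥'   : Formula n
  _⇒'_ : Formula n → Formula n → Formula n
  ∀'   : Formula (suc n) → Formula n

module _ (𝔹 : CompleteBooleanAlgebra) where
  open CompleteBooleanAlgebra 𝔹 renaming (Carrier to B; ⊤ to 𝟙; ⊥ to 𝟘)

  -- λ_c-terms (de Bruijn, n free variables) and stacks of A_𝔹.
  -- Stack bottoms are ω_p, p ∈ 𝔹; there are no special instructions.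

  mutual
    data Term (n : ℕ) : Set where
      var : Fin n → Term n
      app : Term n → Term n → Term n
      lam : Term (suc n) → Term n
      cc  : Term n
      k   : Stack → Term n

    data Stack : Set where
      ω   : B → Stack
      _·_ : Term 0 → Stack → Stack

  Λ : Set
  Λ = Term 0

  mutual
    τT : {n : ℕ} → Term n → B
    τT (var x)   = 𝟙
    τT (app t s) = τT t ∧ τT s
    τT (lam t)   = τT t
    τT cc        = 𝟙
    τT (k π)     = τS π

    τS : Stack → B
    τS (ω p)   = p
    τS (t · π) = τT t ∧ τS π

  τP : Λ → Stack → B
  τP t π = τT t ∧ τS π

  _⋆_∈⊥⊥ : Λ → Stack → Set
  t ⋆ π ∈⊥⊥ = τP t π ≈ 𝟘

  _⊩_ : Λ → (Stack → Set₁) → Set₁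
  t ⊩ F = (π : Stack) → F π → t ⋆ π ∈⊥⊥

  -- Names N^A: a name is a set of pairs (name, stack), rendered
  -- Aczel-style as a family of such pairs indexed by a small type.
  -- (c , π) ∈ a  iff  c ≡ nm i and π ≡ st i for some index i.

  data Name : Set₁ where
    sup : (I : Set) → (I → Name) → (I → Stack) → Name

  mutual
    ‖_∉_‖ : Name → Name → Stack → Set₁
    ‖ a ∉ sup I nm st ‖ (t · (t' · π)) =
      Σ I λ i → (st i ≡ π) × (t ⊩ ‖ a ⊆ nm i ‖) × (t' ⊩ ‖ nm i ⊆ a ‖)
    ‖ a ∉ sup I nm st ‖ (t · ω _) = Lift _ ⊥
    ‖ a ∉ sup I nm st ‖ (ω _) = Lift _ ⊥

    ‖_⊆_‖ : Name → Name → Stack → Set₁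
    ‖ sup I nm st ⊆ b ‖ (t · π) =
      Σ I λ i → (st i ≡ π) × (t ⊩ ‖ nm i ∉ b ‖)
    ‖ sup I nm st ⊆ b ‖ (ω _) = Lift _ ⊥

  _⇛_ : (Stack → Set₁) → (Stack → Set₁) → Stack → Set₁
  (F ⇛ G) (t · π) = (t ⊩ F) × G π
  (F ⇛ G) (ω _)   = Lift _ ⊥

  ‖⊥‖ : Stack → Set₁
  ‖⊥‖ _ = Lift _ ⊤

  ‖_‖ : {n : ℕ} → Formula n → Vector Name n → Stack → Set₁
  ‖ x ∈' y ‖ ρ = ‖ ρ x ∉ ρ y ‖ ⇛ ‖⊥‖
  ‖ x ≃' y ‖ ρ = (‖ ρ x ⊆ ρ y ‖ ⇛ (‖ ρ y ⊆ ρ x ‖ ⇛ ‖⊥‖)) ⇛ ‖⊥‖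
  ‖ ⊥' ‖ ρ = ‖⊥‖
  ‖ φ ⇒' ψ ‖ ρ = ‖ φ ‖ ρ ⇛ ‖ ψ ‖ ρ
  ‖ ∀' φ ‖ ρ π = Σ Name λ a → ‖ φ ‖ (a ∷ ρ) π

  -- The Boolean-valued universe V^𝔹 (Aczel-style: an element is a
  -- family of elements of V^𝔹 each with a Boolean value)

  data V𝔹 : Set₁ where
    vsup : (I : Set) → (I → V𝔹) → (I → B) → V𝔹

  ⟦_≐_⟧ : V𝔹 → V𝔹 → B
  ⟦ vsup I x p ≐ vsup J y q ⟧ =
    (⋀₀ λ i → p i ⇨ (⋁₀ λ j → q j ∧ ⟦ x i ≐ y j ⟧)) ∧
    (⋀₀ λ j → q j ⇨ (⋁₀ λ i → p i ∧ ⟦ x i ≐ y j ⟧))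

  ⟦_∈_⟧ : V𝔹 → V𝔹 → B
  ⟦ u ∈ vsup J y q ⟧ = ⋁₀ λ j → q j ∧ ⟦ u ≐ y j ⟧

  ⟦_⟧ : {n : ℕ} → Formula n → Vector V𝔹 n → B
  ⟦ x ∈' y ⟧ ρ = ⟦ ρ x ∈ ρ y ⟧
  ⟦ x ≃' y ⟧ ρ = ⟦ ρ x ≐ ρ y ⟧
  ⟦ ⊥' ⟧ ρ = 𝟘
  ⟦ φ ⇒' ψ ⟧ ρ = ⟦ φ ⟧ ρ ⇨ ⟦ ψ ⟧ ρ
  ⟦ ∀' φ ⟧ ρ = ⋀ λ u → ⟦ φ ⟧ (u ∷ ρ)

  τN : Name → V𝔹
  τN (sup I nm st) = vsup I (λ i → τN (nm i)) (λ i → τS (st i))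

{-# OPTIONS --safe #-}
-- Extend τ to a set of stacks F by τΠ F = ⋁ {τ(π) : π ∈ F}. As t ⋆ π ∈ ⊥⊥ means
-- τ(t) ∧ τ(π) = 𝟘, a closed term realizes F exactly when τ(t) ≤ ¬ τΠ F =: ∣ F ∣,
-- and the bound is attained by the continuation constant k_{ω ∣F∣}. This gives
-- ∣ F → G ∣ = ∣ F ∣ ⇨ ∣ G ∣ and ∣ ⋃ᵢ Fᵢ ∣ = ⋀ᵢ ∣ Fᵢ ∣, from which ∣ ‖φ(a⃗)‖ ∣ = ⟦φ(τ a⃗)⟧
-- follows by induction on names and then on φ. For ∀, every element of V^𝔹 is,
-- up to structural equality, τ of the name with the same tree and stacks ω p.
module Submission where

open import Defs
open import Data.Nat using (ℕ; suc)
open import Data.Fin using (Fin)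
open import Function using (_∘_)
open import Function.Bundles using (_⇔_)

open import Data.Fin using (zero; suc)
open import Data.Product using (Σ; ∃; _,_; proj₁)
open import Data.Unit using (tt)
open import Data.Vec.Functional using (_∷_)
open import Function.Bundles using (mk⇔; module Equivalence)
open import Level using (Lift; lift; lower; 0ℓ) renaming (suc to lsuc)
open import Relation.Binary.Bundles using (Poset)
open import Relation.Binary.PropositionalEquality as ≡ using (_≡_)
import Algebra.Lattice.Properties.BooleanAlgebra as BooleanAlgebraProperties
import Relation.Binary.Reasoning.PartialOrder as PosetReasoning
import Relation.Binary.Reasoning.Setoid as SetoidReasoning

module CompleteBooleanAlgebraProperties (𝔹 : CompleteBooleanAlgebra) where
  open CompleteBooleanAlgebra 𝔹
    renaming (Carrier to B; ⊤ to 𝟙; ⊥ to 𝟘; _≤_ to infix 4 _≤_; _⇨_ to infixr 5 _⇨_)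
  open BooleanAlgebraProperties boolAlg
    using (∧-idem; ∧-identityˡ; ∧-identityʳ; ∧-zeroʳ; ∨-identityˡ; ∨-identityʳ; ¬-involutive; deMorgan₁)

  ≤-reflexive : ∀ {x y} → x ≈ y → x ≤ y
  ≤-reflexive {x} x≈y = trans (∧-congˡ (sym x≈y)) (∧-idem x)

  ≤-refl : ∀ {x} → x ≤ x
  ≤-refl = ≤-reflexive refl

  ≤-trans : ∀ {x y z} → x ≤ y → y ≤ z → x ≤ z
  ≤-trans {x} {y} {z} x≤y y≤z = begin
    x ∧ z       ≈⟨ ∧-congʳ (sym x≤y) ⟩
    (x ∧ y) ∧ z ≈⟨ ∧-assoc x y z ⟩
    x ∧ (y ∧ z) ≈⟨ ∧-congˡ y≤z ⟩
    x ∧ y       ≈⟨ x≤y ⟩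
    x           ∎
    where open SetoidReasoning setoid

  ≤-antisym : ∀ {x y} → x ≤ y → y ≤ x → x ≈ y
  ≤-antisym {x} {y} x≤y y≤x = begin
    x     ≈⟨ sym x≤y ⟩
    x ∧ y ≈⟨ ∧-comm x y ⟩
    y ∧ x ≈⟨ y≤x ⟩
    y     ∎
    where open SetoidReasoning setoid

  poset : Poset 0ℓ 0ℓ 0ℓ
  poset = record
    { isPartialOrder = record
      { isPreorder = record
        { isEquivalence = isEquivalence ; reflexive = ≤-reflexive ; trans = ≤-trans }
      ; antisym = ≤-antisym } }

  open PosetReasoning poset

  x∧y≤x : ∀ x y → x ∧ y ≤ x
  x∧y≤x x y = begin-equality
    (x ∧ y) ∧ x ≈⟨ ∧-congʳ (∧-comm x y) ⟩
    (y ∧ x) ∧ x ≈⟨ ∧-assoc y x x ⟩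
    y ∧ (x ∧ x) ≈⟨ ∧-congˡ (∧-idem x) ⟩
    y ∧ x       ≈⟨ ∧-comm y x ⟩
    x ∧ y       ∎

  x∧y≤y : ∀ x y → x ∧ y ≤ y
  x∧y≤y x y = begin-equality
    (x ∧ y) ∧ y ≈⟨ ∧-assoc x y y ⟩
    x ∧ (y ∧ y) ≈⟨ ∧-congˡ (∧-idem y) ⟩
    x ∧ y       ∎

  ∧-greatest : ∀ {x y z} → z ≤ x → z ≤ y → z ≤ x ∧ y
  ∧-greatest {x} {y} {z} z≤x z≤y = begin-equality
    z ∧ (x ∧ y) ≈⟨ sym (∧-assoc z x y) ⟩
    (z ∧ x) ∧ y ≈⟨ ∧-congʳ z≤x ⟩
    z ∧ y       ≈⟨ z≤y ⟩
    z           ∎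

  ∧-monotonic : ∀ {x x' y y'} → x ≤ x' → y ≤ y' → x ∧ y ≤ x' ∧ y'
  ∧-monotonic {x} {_} {y} x≤x' y≤y' =
    ∧-greatest (≤-trans (x∧y≤x x y) x≤x') (≤-trans (x∧y≤y x y) y≤y')

  x≤𝟙 : ∀ x → x ≤ 𝟙
  x≤𝟙 = ∧-identityʳ

  x≤x∨y : ∀ x y → x ≤ x ∨ y
  x≤x∨y = ∧-absorbs-∨

  ∨-monotonicʳ : ∀ x {y y'} → y ≤ y' → x ∨ y ≤ x ∨ y'
  ∨-monotonicʳ x {y} {y'} y≤y' = begin-equality
    (x ∨ y) ∧ (x ∨ y') ≈⟨ sym (∨-distribˡ-∧ x y y') ⟩
    x ∨ (y ∧ y')       ≈⟨ ∨-congˡ y≤y' ⟩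
    x ∨ y              ∎

  x∧y≈𝟘⇒x≤¬y : ∀ {x y} → x ∧ y ≈ 𝟘 → x ≤ ¬ y
  x∧y≈𝟘⇒x≤¬y {x} {y} x∧y≈𝟘 = sym (begin-equality
    x                   ≈⟨ sym (∧-identityʳ x) ⟩
    x ∧ 𝟙               ≈⟨ ∧-congˡ (sym (∨-complementʳ y)) ⟩
    x ∧ (y ∨ ¬ y)       ≈⟨ ∧-distribˡ-∨ x y (¬ y) ⟩
    (x ∧ y) ∨ (x ∧ ¬ y) ≈⟨ ∨-congʳ x∧y≈𝟘 ⟩
    𝟘 ∨ (x ∧ ¬ y)       ≈⟨ ∨-identityˡ _ ⟩
    x ∧ ¬ y             ∎)

  x≤¬y⇒x∧y≈𝟘 : ∀ {x y} → x ≤ ¬ y → x ∧ y ≈ 𝟘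
  x≤¬y⇒x∧y≈𝟘 {x} {y} x≤¬y = begin-equality
    x ∧ y         ≈⟨ ∧-congʳ (sym x≤¬y) ⟩
    (x ∧ ¬ y) ∧ y ≈⟨ ∧-assoc x (¬ y) y ⟩
    x ∧ (¬ y ∧ y) ≈⟨ ∧-congˡ (∧-complementˡ y) ⟩
    x ∧ 𝟘         ≈⟨ ∧-zeroʳ x ⟩
    𝟘             ∎

  x≤¬y⇒y≤¬x : ∀ {x y} → x ≤ ¬ y → y ≤ ¬ x
  x≤¬y⇒y≤¬x {x} {y} x≤¬y = x∧y≈𝟘⇒x≤¬y (trans (∧-comm y x) (x≤¬y⇒x∧y≈𝟘 x≤¬y))

  ¬-antitone : ∀ {x y} → x ≤ y → ¬ y ≤ ¬ x
  ¬-antitone {x} {y} x≤y = x≤¬y⇒y≤¬x (≤-trans x≤y (≤-reflexive (sym (¬-involutive y))))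

  ∧-residual : ∀ {x y z} → x ∧ z ≤ y → z ≤ x ⇨ y
  ∧-residual {x} {y} {z} x∧z≤y = begin
    z               ≤⟨ x≤x∨y z (¬ x) ⟩
    z ∨ ¬ x         ≈⟨ ∨-comm z (¬ x) ⟩
    ¬ x ∨ z         ≈⟨ sym (∧-identityˡ _) ⟩
    𝟙 ∧ (¬ x ∨ z)   ≈⟨ ∧-congʳ (sym (∨-complementˡ x)) ⟩
    (¬ x ∨ x) ∧ (¬ x ∨ z) ≈⟨ sym (∨-distribˡ-∧ (¬ x) x z) ⟩
    ¬ x ∨ (x ∧ z)   ≤⟨ ∨-monotonicʳ (¬ x) x∧z≤y ⟩
    ¬ x ∨ y         ∎

  ∧-residual⁻¹ : ∀ {x y z} → z ≤ x ⇨ y → x ∧ z ≤ y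
  ∧-residual⁻¹ {x} {y} {z} z≤x⇨y = begin
    x ∧ z               ≤⟨ ∧-monotonic (≤-refl {x}) z≤x⇨y ⟩
    x ∧ (¬ x ∨ y)       ≈⟨ ∧-distribˡ-∨ x (¬ x) y ⟩
    (x ∧ ¬ x) ∨ (x ∧ y) ≈⟨ ∨-congʳ (∧-complementʳ x) ⟩
    𝟘 ∨ (x ∧ y)         ≈⟨ ∨-identityˡ _ ⟩
    x ∧ y               ≤⟨ x∧y≤y x y ⟩
    y                   ∎

  ⇨-cong : ∀ {x x' y y'} → x ≈ x' → y ≈ y' → x ⇨ y ≈ x' ⇨ y'
  ⇨-cong x≈x' y≈y' = ∨-cong (¬-cong x≈x') y≈y'

  x⇨𝟘≈¬x : ∀ x → x ⇨ 𝟘 ≈ ¬ x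
  x⇨𝟘≈¬x x = ∨-identityʳ (¬ x)

  x⇨¬y≈¬[x∧y] : ∀ x y → x ⇨ ¬ y ≈ ¬ (x ∧ y)
  x⇨¬y≈¬[x∧y] x y = sym (deMorgan₁ x y)

  ¬x⇨¬y≈y⇨x : ∀ x y → ¬ x ⇨ ¬ y ≈ y ⇨ x
  ¬x⇨¬y≈y⇨x x y = trans (∨-congʳ (¬-involutive x)) (∨-comm x (¬ y))

  ⋁-cong : ∀ {I : Set₁} {f g : I → B} → (∀ i → f i ≈ g i) → ⋁ f ≈ ⋁ g
  ⋁-cong {f = f} {g} f≈g = ≤-antisym
    (⋁-least f _ λ i → ≤-trans (≤-reflexive (f≈g i)) (⋁-upper g i))
    (⋁-least g _ λ i → ≤-trans (≤-reflexive (sym (f≈g i))) (⋁-upper f i))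

  ⋀-cong : ∀ {I : Set₁} {f g : I → B} → (∀ i → f i ≈ g i) → ⋀ f ≈ ⋀ g
  ⋀-cong {f = f} {g} f≈g = ≤-antisym
    (⋀-greatest g _ λ i → ≤-trans (⋀-lower f i) (≤-reflexive (f≈g i)))
    (⋀-greatest f _ λ i → ≤-trans (⋀-lower g i) (≤-reflexive (sym (f≈g i))))

  ⋁₀-cong : ∀ {I : Set} {f g : I → B} → (∀ i → f i ≈ g i) → ⋁₀ f ≈ ⋁₀ g
  ⋁₀-cong f≈g = ⋁-cong (f≈g ∘ lower)

  ⋀₀-cong : ∀ {I : Set} {f g : I → B} → (∀ i → f i ≈ g i) → ⋀₀ f ≈ ⋀₀ g
  ⋀₀-cong f≈g = ⋀-cong (f≈g ∘ lower)

  ¬-⋁ : ∀ {I : Set₁} (f : I → B) → ¬ ⋁ f ≈ ⋀ (¬_ ∘ f)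
  ¬-⋁ f = ≤-antisym
    (⋀-greatest _ _ λ i → ¬-antitone (⋁-upper f i))
    (x≤¬y⇒y≤¬x (⋁-least f _ λ i → x≤¬y⇒y≤¬x (⋀-lower (¬_ ∘ f) i)))

  ¬-⋁₀ : ∀ {I : Set} (f : I → B) → ¬ ⋁₀ f ≈ ⋀₀ (¬_ ∘ f)
  ¬-⋁₀ f = ¬-⋁ (f ∘ lower)

  ∧-⋁-least : ∀ {I : Set₁} {x y} (f : I → B) → (∀ i → x ∧ f i ≤ y) → x ∧ ⋁ f ≤ y
  ∧-⋁-least f x∧f≤y = ∧-residual⁻¹ (⋁-least f _ λ i → ∧-residual (x∧f≤y i))

  ⋀-reindex : ∀ {I J : Set₁} (f : J → B) (h : I → J) →
              (∀ j → ∃ λ i → f (h i) ≈ f j) → ⋀ (f ∘ h) ≈ ⋀ f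
  ⋀-reindex f h surjective = ≤-antisym
    (⋀-greatest f _ λ j → let (i , fhi≈fj) = surjective j in
      ≤-trans (⋀-lower (f ∘ h) i) (≤-reflexive fhi≈fj))
    (⋀-greatest (f ∘ h) _ λ i → ⋀-lower f (h i))

module FalsityValues (𝔹 : CompleteBooleanAlgebra) where
  open CompleteBooleanAlgebra 𝔹
    renaming (Carrier to B; ⊤ to 𝟙; ⊥ to 𝟘; _≤_ to infix 4 _≤_; _⇨_ to infixr 5 _⇨_)
  open CompleteBooleanAlgebraProperties 𝔹
  open BooleanAlgebraProperties boolAlg using (deMorgan₁; ¬⊤≈⊥)
  open import Relation.Unary using (Pred; _⊆_; _≐_; ⋃)

  FalsityValue : Set₂
  FalsityValue = Pred (Stack 𝔹) (lsuc 0ℓ)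

  ｛_｝₁ : Stack 𝔹 → FalsityValue
  ｛ π ｝₁ σ = Lift _ (π ≡ σ)

  τΠ : FalsityValue → B
  τΠ F = ⋁ {Σ (Stack 𝔹) F} (τS 𝔹 ∘ proj₁)

  ∣_∣ : FalsityValue → B
  ∣ F ∣ = ¬ τΠ F

  τΠ-upper : ∀ {F π} → F π → τS 𝔹 π ≤ τΠ F
  τΠ-upper {π = π} π∈F = ⋁-upper _ (π , π∈F)

  τΠ-mono : ∀ {F G} → F ⊆ G → τΠ F ≤ τΠ G
  τΠ-mono F⊆G = ⋁-least _ _ λ (π , π∈F) → τΠ-upper (F⊆G π∈F)

  ∣∣-cong : ∀ {F G} → F ≐ G → ∣ F ∣ ≈ ∣ G ∣
  ∣∣-cong (F⊆G , G⊆F) = ¬-cong (≤-antisym (τΠ-mono F⊆G) (τΠ-mono G⊆F))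

  ⊩⇔≤∣∣ : ∀ (t : Λ 𝔹) F → _⊩_ 𝔹 t F ⇔ τT 𝔹 t ≤ ∣ F ∣
  ⊩⇔≤∣∣ t F = mk⇔
    (λ t⊩F → x≤¬y⇒y≤¬x (⋁-least _ _ λ (π , π∈F) →
      x∧y≈𝟘⇒x≤¬y (trans (∧-comm _ _) (t⊩F π π∈F))))
    (λ τt≤∣F∣ π π∈F → x≤¬y⇒x∧y≈𝟘 (≤-trans τt≤∣F∣ (¬-antitone (τΠ-upper π∈F))))

  τΠ-⇛ : ∀ F G → τΠ (_⇛_ 𝔹 F G) ≈ ∣ F ∣ ∧ τΠ G
  τΠ-⇛ F G = ≤-antisym
    (⋁-least _ _ λ
      { ((t · π) , t⊩F , π∈G) → ∧-monotonic (Equivalence.to (⊩⇔≤∣∣ t F) t⊩F) (τΠ-upper π∈G)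
      ; (ω _ , lift ()) })
    (∧-⋁-least _ λ (π , π∈G) → τΠ-upper {π = κ · π} (κ⊩F , π∈G))
    where
    κ : Λ 𝔹
    κ = k (ω ∣ F ∣)
    κ⊩F : _⊩_ 𝔹 κ F
    κ⊩F = Equivalence.from (⊩⇔≤∣∣ κ F) ≤-refl

  ∣⇛∣ : ∀ F G → ∣ _⇛_ 𝔹 F G ∣ ≈ ∣ F ∣ ⇨ ∣ G ∣
  ∣⇛∣ F G = trans (¬-cong (τΠ-⇛ F G)) (deMorgan₁ _ _)

  ∣‖⊥‖∣ : ∣ ‖⊥‖ 𝔹 ∣ ≈ 𝟘
  ∣‖⊥‖∣ = trans (¬-cong (≤-antisym (x≤𝟙 _) (τΠ-upper {π = ω 𝟙} (lift tt)))) ¬⊤≈⊥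

  ∣¬∣ : ∀ F → ∣ _⇛_ 𝔹 F (‖⊥‖ 𝔹) ∣ ≈ ¬ ∣ F ∣
  ∣¬∣ F = trans (∣⇛∣ F (‖⊥‖ 𝔹)) (trans (⇨-cong refl ∣‖⊥‖∣) (x⇨𝟘≈¬x ∣ F ∣))

  ∣｛｝∣ : ∀ π → ∣ ｛ π ｝₁ ∣ ≈ ¬ τS 𝔹 π
  ∣｛｝∣ π = ¬-cong (≤-antisym
    (⋁-least _ _ λ { (_ , lift ≡.refl) → ≤-refl })
    (τΠ-upper (lift ≡.refl)))

  τΠ-⋃ : ∀ {I : Set₁} (P : I → FalsityValue) → τΠ (⋃ I P) ≈ ⋁ (τΠ ∘ P)
  τΠ-⋃ P = ≤-antisym
    (⋁-least _ _ λ (π , i , π∈Pi) → ≤-trans (τΠ-upper π∈Pi) (⋁-upper (τΠ ∘ P) i))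
    (⋁-least _ _ λ i → τΠ-mono λ π∈Pi → i , π∈Pi)

  ∣⋃∣ : ∀ {I : Set₁} (P : I → FalsityValue) → ∣ ⋃ I P ∣ ≈ ⋀ (∣_∣ ∘ P)
  ∣⋃∣ P = trans (¬-cong (τΠ-⋃ P)) (¬-⋁ (τΠ ∘ P))

  ∣⋃₀∣ : ∀ {I : Set} (P : I → FalsityValue) → ∣ ⋃ I P ∣ ≈ ⋀₀ (∣_∣ ∘ P)
  ∣⋃₀∣ P = trans
    (∣∣-cong ((λ (i , π∈Pi) → lift i , π∈Pi) , (λ (i , π∈Pi) → lower i , π∈Pi)))
    (∣⋃∣ (P ∘ lower))

module BooleanValuedUniverse (𝔹 : CompleteBooleanAlgebra) where
  open CompleteBooleanAlgebra 𝔹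
    renaming (Carrier to B; _⇨_ to infixr 5 _⇨_)
  open CompleteBooleanAlgebraProperties 𝔹

  ⟦_⊆_⟧ : V𝔹 𝔹 → V𝔹 𝔹 → B
  ⟦ vsup I x p ⊆ w ⟧ = ⋀₀ λ i → p i ⇨ ⟦_∈_⟧ 𝔹 (x i) w

  ⟦≐⟧-sym : ∀ u w → ⟦_≐_⟧ 𝔹 u w ≈ ⟦_≐_⟧ 𝔹 w u
  ⟦≐⟧-sym (vsup I x p) (vsup J y q) = trans (∧-comm _ _) (∧-cong
    (⋀₀-cong λ j → ⇨-cong refl (⋁₀-cong λ i → ∧-cong refl (⟦≐⟧-sym (x i) (y j))))
    (⋀₀-cong λ i → ⇨-cong refl (⋁₀-cong λ j → ∧-cong refl (⟦≐⟧-sym (x i) (y j)))))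

  ⟦≐⟧≈⟦⊆⟧∧⟦⊇⟧ : ∀ u w → ⟦_≐_⟧ 𝔹 u w ≈ ⟦ u ⊆ w ⟧ ∧ ⟦ w ⊆ u ⟧
  ⟦≐⟧≈⟦⊆⟧∧⟦⊇⟧ (vsup I x p) (vsup J y q) = ∧-cong refl
    (⋀₀-cong λ j → ⇨-cong refl (⋁₀-cong λ i → ∧-cong refl (⟦≐⟧-sym (x i) (y j))))

  -- Without function extensionality, τN (canonicalName u) equals u only up to
  -- this structural equality.
  infix 4 _≅_
  data _≅_ : V𝔹 𝔹 → V𝔹 𝔹 → Set₁ where
    vsup-cong : ∀ {I x x' p p'} → (∀ i → x i ≅ x' i) → (∀ i → p i ≈ p' i) →
                vsup I x p ≅ vsup I x' p'

  ≅-refl : ∀ u → u ≅ u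
  ≅-refl (vsup I x p) = vsup-cong (λ i → ≅-refl (x i)) (λ i → refl)

  ⟦≐⟧-cong : ∀ {u u' w w'} → u ≅ u' → w ≅ w' → ⟦_≐_⟧ 𝔹 u w ≈ ⟦_≐_⟧ 𝔹 u' w'
  ⟦≐⟧-cong (vsup-cong x≅x' p≈p') (vsup-cong y≅y' q≈q') = ∧-cong
    (⋀₀-cong λ i → ⇨-cong (p≈p' i) (⋁₀-cong λ j → ∧-cong (q≈q' j) (⟦≐⟧-cong (x≅x' i) (y≅y' j))))
    (⋀₀-cong λ j → ⇨-cong (q≈q' j) (⋁₀-cong λ i → ∧-cong (p≈p' i) (⟦≐⟧-cong (x≅x' i) (y≅y' j))))

  ⟦∈⟧-cong : ∀ {u u' w w'} → u ≅ u' → w ≅ w' → ⟦_∈_⟧ 𝔹 u w ≈ ⟦_∈_⟧ 𝔹 u' w'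
  ⟦∈⟧-cong u≅u' (vsup-cong y≅y' q≈q') = ⋁₀-cong λ j → ∧-cong (q≈q' j) (⟦≐⟧-cong u≅u' (y≅y' j))

  ⟦⟧-cong : ∀ {n} (φ : Formula n) {σ σ' : Fin n → V𝔹 𝔹} →
            (∀ i → σ i ≅ σ' i) → ⟦_⟧ 𝔹 φ σ ≈ ⟦_⟧ 𝔹 φ σ'
  ⟦⟧-cong (x ∈' y) σ≅σ' = ⟦∈⟧-cong (σ≅σ' x) (σ≅σ' y)
  ⟦⟧-cong (x ≃' y) σ≅σ' = ⟦≐⟧-cong (σ≅σ' x) (σ≅σ' y)
  ⟦⟧-cong ⊥' σ≅σ' = refl
  ⟦⟧-cong (φ ⇒' ψ) σ≅σ' = ⇨-cong (⟦⟧-cong φ σ≅σ') (⟦⟧-cong ψ σ≅σ')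
  ⟦⟧-cong (∀' φ) σ≅σ' = ⋀-cong λ u → ⟦⟧-cong φ λ
    { zero → ≅-refl u
    ; (suc i) → σ≅σ' i }

  canonicalName : V𝔹 𝔹 → Name 𝔹
  canonicalName (vsup I x p) = sup I (canonicalName ∘ x) (ω ∘ p)

  τN-canonicalName : ∀ u → τN 𝔹 (canonicalName u) ≅ u
  τN-canonicalName (vsup I x p) = vsup-cong (τN-canonicalName ∘ x) (λ i → refl)

module Correspondence (𝔹 : CompleteBooleanAlgebra) where
  open CompleteBooleanAlgebra 𝔹
    renaming (_≤_ to infix 4 _≤_; _⇨_ to infixr 5 _⇨_)
  open CompleteBooleanAlgebraProperties 𝔹
  open FalsityValues 𝔹
  open BooleanValuedUniverse 𝔹
  open BooleanAlgebraProperties boolAlg using (¬-involutive)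
  open Poset poset using (≤-respʳ-≈)
  open import Relation.Unary using (_≐_; ⋃)
  open SetoidReasoning setoid

  ‖⊆‖≐⋃ : ∀ {I} (nm : I → Name 𝔹) st b →
          ‖_⊆_‖ 𝔹 (sup I nm st) b ≐ ⋃ I λ i → _⇛_ 𝔹 (‖_∉_‖ 𝔹 (nm i) b) ｛ st i ｝₁
  ‖⊆‖≐⋃ nm st b =
    (λ { {t · π} (i , ≡.refl , t⊩) → i , t⊩ , lift ≡.refl ; {ω _} (lift ()) }) ,
    (λ { {t · π} (i , t⊩ , lift ≡.refl) → i , ≡.refl , t⊩ ; {ω _} (_ , lift ()) })

  ‖∉‖≐⋃ : ∀ a {I} (nm : I → Name 𝔹) st →
          ‖_∉_‖ 𝔹 a (sup I nm st) ≐
          ⋃ I λ i → _⇛_ 𝔹 (‖_⊆_‖ 𝔹 a (nm i)) (_⇛_ 𝔹 (‖_⊆_‖ 𝔹 (nm i) a) ｛ st i ｝₁)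
  ‖∉‖≐⋃ a nm st =
    (λ { {t · (t' · π)} (i , ≡.refl , t⊩ , t'⊩) → i , t⊩ , t'⊩ , lift ≡.refl
       ; {t · ω _} (lift ())
       ; {ω _} (lift ()) }) ,
    (λ { {t · (t' · π)} (i , t⊩ , t'⊩ , lift ≡.refl) → i , ≡.refl , t⊩ , t'⊩
       ; {t · ω _} (_ , _ , lift ())
       ; {ω _} (_ , lift ()) })

  mutual
    ∣‖∉‖∣ : ∀ a b → ∣ ‖_∉_‖ 𝔹 a b ∣ ≈ ¬ ⟦_∈_⟧ 𝔹 (τN 𝔹 a) (τN 𝔹 b)
    ∣‖∉‖∣ a (sup I nm st) = begin
      ∣ ‖_∉_‖ 𝔹 a (sup I nm st) ∣                           ≈⟨ ∣∣-cong (‖∉‖≐⋃ a nm st) ⟩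
      ∣ ⋃ I (λ i → _⇛_ 𝔹 (⊆nm i) (_⇛_ 𝔹 (nm⊆ i) ｛ st i ｝₁)) ∣ ≈⟨ ∣⋃₀∣ _ ⟩
      ⋀₀ (λ i → ∣ _⇛_ 𝔹 (⊆nm i) (_⇛_ 𝔹 (nm⊆ i) ｛ st i ｝₁) ∣) ≈⟨ ⋀₀-cong value ⟩
      ⋀₀ (λ i → ¬ (p i ∧ ⟦_≐_⟧ 𝔹 x (y i)))                   ≈⟨ ¬-⋁₀ _ ⟨
      ¬ ⟦_∈_⟧ 𝔹 x (τN 𝔹 (sup I nm st))                        ∎
      where
      x = τN 𝔹 a
      y = τN 𝔹 ∘ nm
      p = τS 𝔹 ∘ st
      ⊆nm nm⊆ : I → FalsityValue
      ⊆nm i = ‖_⊆_‖ 𝔹 a (nm i)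
      nm⊆ i = ‖_⊆_‖ 𝔹 (nm i) a
      value : ∀ i → ∣ _⇛_ 𝔹 (⊆nm i) (_⇛_ 𝔹 (nm⊆ i) ｛ st i ｝₁) ∣ ≈ ¬ (p i ∧ ⟦_≐_⟧ 𝔹 x (y i))
      value i = begin
        ∣ _⇛_ 𝔹 (⊆nm i) (_⇛_ 𝔹 (nm⊆ i) ｛ st i ｝₁) ∣ ≈⟨ ∣⇛∣ _ _ ⟩
        ∣ ⊆nm i ∣ ⇨ ∣ _⇛_ 𝔹 (nm⊆ i) ｛ st i ｝₁ ∣      ≈⟨ ⇨-cong (∣‖⊆‖∣ a (nm i)) (∣⇛∣ _ _) ⟩
        ⟦ x ⊆ y i ⟧ ⇨ ∣ nm⊆ i ∣ ⇨ ∣ ｛ st i ｝₁ ∣     ≈⟨ ⇨-cong refl (⇨-cong (∣‖⊆‖∣ (nm i) a) (∣｛｝∣ (st i))) ⟩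
        ⟦ x ⊆ y i ⟧ ⇨ ⟦ y i ⊆ x ⟧ ⇨ ¬ p i           ≈⟨ ⇨-cong refl (x⇨¬y≈¬[x∧y] _ _) ⟩
        ⟦ x ⊆ y i ⟧ ⇨ ¬ (⟦ y i ⊆ x ⟧ ∧ p i)         ≈⟨ x⇨¬y≈¬[x∧y] _ _ ⟩
        ¬ (⟦ x ⊆ y i ⟧ ∧ ⟦ y i ⊆ x ⟧ ∧ p i)         ≈⟨ ¬-cong (∧-assoc _ _ _) ⟨
        ¬ ((⟦ x ⊆ y i ⟧ ∧ ⟦ y i ⊆ x ⟧) ∧ p i)       ≈⟨ ¬-cong (∧-comm _ _) ⟩
        ¬ (p i ∧ ⟦ x ⊆ y i ⟧ ∧ ⟦ y i ⊆ x ⟧)         ≈⟨ ¬-cong (∧-cong refl (⟦≐⟧≈⟦⊆⟧∧⟦⊇⟧ x (y i))) ⟨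
        ¬ (p i ∧ ⟦_≐_⟧ 𝔹 x (y i))                   ∎

    ∣‖⊆‖∣ : ∀ a b → ∣ ‖_⊆_‖ 𝔹 a b ∣ ≈ ⟦ τN 𝔹 a ⊆ τN 𝔹 b ⟧
    ∣‖⊆‖∣ (sup I nm st) b = begin
      ∣ ‖_⊆_‖ 𝔹 (sup I nm st) b ∣                          ≈⟨ ∣∣-cong (‖⊆‖≐⋃ nm st b) ⟩
      ∣ ⋃ I (λ i → _⇛_ 𝔹 (‖_∉_‖ 𝔹 (nm i) b) ｛ st i ｝₁) ∣   ≈⟨ ∣⋃₀∣ _ ⟩
      ⋀₀ (λ i → ∣ _⇛_ 𝔹 (‖_∉_‖ 𝔹 (nm i) b) ｛ st i ｝₁ ∣)   ≈⟨ ⋀₀-cong value ⟩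
      ⋀₀ (λ i → τS 𝔹 (st i) ⇨ ⟦_∈_⟧ 𝔹 (τN 𝔹 (nm i)) (τN 𝔹 b)) ∎
      where
      value : ∀ i → ∣ _⇛_ 𝔹 (‖_∉_‖ 𝔹 (nm i) b) ｛ st i ｝₁ ∣ ≈
                    τS 𝔹 (st i) ⇨ ⟦_∈_⟧ 𝔹 (τN 𝔹 (nm i)) (τN 𝔹 b)
      value i = trans (∣⇛∣ _ _)
        (trans (⇨-cong (∣‖∉‖∣ (nm i) b) (∣｛｝∣ (st i))) (¬x⇨¬y≈y⇨x _ _))

  ∣‖‖∣ : ∀ {n} (φ : Formula n) (ρ : Fin n → Name 𝔹) → ∣ ‖_‖ 𝔹 φ ρ ∣ ≈ ⟦_⟧ 𝔹 φ (τN 𝔹 ∘ ρ)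
  ∣‖‖∣ (x ∈' y) ρ =
    trans (∣¬∣ _) (trans (¬-cong (∣‖∉‖∣ (ρ x) (ρ y))) (¬-involutive _))
  ∣‖‖∣ (x ≃' y) ρ = trans (∣¬∣ _) (trans (¬-cong ∣⊆⇒⊇⇒⊥∣) (¬-involutive _))
    where
    u = τN 𝔹 (ρ x)
    w = τN 𝔹 (ρ y)
    ‖u⊆w‖ ‖w⊆u‖ : FalsityValue
    ‖u⊆w‖ = ‖_⊆_‖ 𝔹 (ρ x) (ρ y)
    ‖w⊆u‖ = ‖_⊆_‖ 𝔹 (ρ y) (ρ x)
    ∣⊆⇒⊇⇒⊥∣ : ∣ _⇛_ 𝔹 ‖u⊆w‖ (_⇛_ 𝔹 ‖w⊆u‖ (‖⊥‖ 𝔹)) ∣ ≈ ¬ ⟦_≐_⟧ 𝔹 u w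
    ∣⊆⇒⊇⇒⊥∣ = begin
      ∣ _⇛_ 𝔹 ‖u⊆w‖ (_⇛_ 𝔹 ‖w⊆u‖ (‖⊥‖ 𝔹)) ∣   ≈⟨ ∣⇛∣ _ _ ⟩
      ∣ ‖u⊆w‖ ∣ ⇨ ∣ _⇛_ 𝔹 ‖w⊆u‖ (‖⊥‖ 𝔹) ∣     ≈⟨ ⇨-cong (∣‖⊆‖∣ (ρ x) (ρ y)) (∣¬∣ _) ⟩
      ⟦ u ⊆ w ⟧ ⇨ ¬ ∣ ‖w⊆u‖ ∣                  ≈⟨ ⇨-cong refl (¬-cong (∣‖⊆‖∣ (ρ y) (ρ x))) ⟩
      ⟦ u ⊆ w ⟧ ⇨ ¬ ⟦ w ⊆ u ⟧                  ≈⟨ x⇨¬y≈¬[x∧y] _ _ ⟩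
      ¬ (⟦ u ⊆ w ⟧ ∧ ⟦ w ⊆ u ⟧)                ≈⟨ ¬-cong (⟦≐⟧≈⟦⊆⟧∧⟦⊇⟧ u w) ⟨
      ¬ ⟦_≐_⟧ 𝔹 u w                            ∎
  ∣‖‖∣ ⊥' ρ = ∣‖⊥‖∣
  ∣‖‖∣ (φ ⇒' ψ) ρ = trans (∣⇛∣ _ _) (⇨-cong (∣‖‖∣ φ ρ) (∣‖‖∣ ψ ρ))
  ∣‖‖∣ (∀' φ) ρ = begin
    ∣ ⋃ (Name 𝔹) (λ a → ‖_‖ 𝔹 φ (a ∷ ρ)) ∣    ≈⟨ ∣⋃∣ _ ⟩
    ⋀ (λ a → ∣ ‖_‖ 𝔹 φ (a ∷ ρ) ∣)            ≈⟨ ⋀-cong (λ a → trans (∣‖‖∣ φ (a ∷ ρ)) (⟦⟧-cong φ (τN-∷ a))) ⟩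
    ⋀ (λ a → ⟦_⟧ 𝔹 φ (τN 𝔹 a ∷ τN 𝔹 ∘ ρ))    ≈⟨ ⋀-reindex (λ u → ⟦_⟧ 𝔹 φ (u ∷ τN 𝔹 ∘ ρ)) (τN 𝔹) τN-surjective ⟩
    ⋀ (λ u → ⟦_⟧ 𝔹 φ (u ∷ τN 𝔹 ∘ ρ))         ∎
    where
    τN-∷ : ∀ a i → (τN 𝔹 ∘ (a ∷ ρ)) i ≅ (τN 𝔹 a ∷ τN 𝔹 ∘ ρ) i
    τN-∷ a zero    = ≅-refl _
    τN-∷ a (suc i) = ≅-refl _
    τN-surjective : ∀ u → ∃ λ a → ⟦_⟧ 𝔹 φ (τN 𝔹 a ∷ τN 𝔹 ∘ ρ) ≈ ⟦_⟧ 𝔹 φ (u ∷ τN 𝔹 ∘ ρ)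
    τN-surjective u = canonicalName u , ⟦⟧-cong φ λ
      { zero    → τN-canonicalName u
      ; (suc i) → ≅-refl _ }

  ⊩‖‖⇔≤⟦⟧ : ∀ {n} (φ : Formula n) (t : Λ 𝔹) (ρ : Fin n → Name 𝔹) →
            _⊩_ 𝔹 t (‖_‖ 𝔹 φ ρ) ⇔ τT 𝔹 t ≤ ⟦_⟧ 𝔹 φ (τN 𝔹 ∘ ρ)
  ⊩‖‖⇔≤⟦⟧ φ t ρ = mk⇔
    (≤-respʳ-≈ (∣‖‖∣ φ ρ) ∘ Equivalence.to (⊩⇔≤∣∣ t _))
    (Equivalence.from (⊩⇔≤∣∣ t _) ∘ ≤-respʳ-≈ (sym (∣‖‖∣ φ ρ)))

theorem19p6 : (𝔹 : CompleteBooleanAlgebra) (n : ℕ) (φ : Formula (suc n))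
    (t : Λ 𝔹) (a : Fin (suc n) → Name 𝔹) →
    (_⊩_ 𝔹 t (‖_‖ 𝔹 φ a)) ⇔
    CompleteBooleanAlgebra._≤_ 𝔹 (τT 𝔹 t) (⟦_⟧ 𝔹 φ (τN 𝔹 ∘ a))
theorem19p6 𝔹 n φ t a = Correspondence.⊩‖‖⇔≤⟦⟧ 𝔹 φ t a
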